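{- For each positive integer $n$ divisible by $6$ there is a connected $n$-vertex graph $H_n$ which contains a spanning tree with $n/2+2$ leaves, and for which $D(H_n)\to 41/54=3/4+1/108$ as $n\to\infty$ (over $n$ divisible by $6$).
   Context: All graphs are finite and simple. For a graph $G$, a non-empty set $S\subseteq V(G)$ is a connected set if $G[S]$ is connected. For an $n$-vertex connected graph $G$, the connected set density $D(G)$ is the average cardinality of the connected sets of $G$ divided by $n$. -}

module Defs where

open import Data.Nat using (ℕ; zero; suc; _+_; _*_; _≤_; _≡ᵇ_)
open import Data.Bool using (Bool; true; false)
open import Data.Fin using (Fin)
open import Data.Fin.Subset using (Subset; _∈_; ∣_∣; Nonempty)
open import Data.Vec using (tabulate)
open import Data.List using (List; []; _∷_; length; map)
open import Data.Nat.ListAction using (sum)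
open import Data.List.Relation.Unary.Unique.Propositional using (Unique)
import Data.List.Membership.Propositional as LM
open import Data.Product using (_×_; Σ)
open import Data.Integer using (+_)
open import Data.Rational using (ℚ; _/_; 0ℚ)
open import Relation.Binary.PropositionalEquality using (_≡_)
open import Function.Bundles using (_⇔_)

record Graph (n : ℕ) : Set where
  field
    adj    : Fin n → Fin n → Bool
    sym    : ∀ u v → adj u v ≡ adj v u
    irrefl : ∀ v → adj v v ≡ false
open Graph public

data PathIn {n : ℕ} (G : Graph n) (S : Subset n) : Fin n → Fin n → Set where
  here : ∀ {u} → u ∈ S → PathIn G S u u
  step : ∀ {u w v} → u ∈ S → adj G u w ≡ true → PathIn G S w v → PathIn G S u v

ConnectedSet : {n : ℕ} → Graph n → Subset n → Set
ConnectedSet G S = Nonempty S × (∀ u v → u ∈ S → v ∈ S → PathIn G S u v)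

full : (n : ℕ) → Subset n
full n = tabulate (λ _ → true)

Connected : {n : ℕ} → Graph n → Set
Connected {n} G = ConnectedSet G (full n)

Linked : {n : ℕ} → Graph n → Fin n → List (Fin n) → Fin n → Set
Linked G u []       v = adj G u v ≡ true
Linked G u (w ∷ ws) v = (adj G u w ≡ true) × Linked G w ws v

Cycle : {n : ℕ} → Graph n → Fin n → List (Fin n) → Set
Cycle G x xs = (2 ≤ length xs) × Unique (x ∷ xs) × Linked G x xs x

Acyclic : {n : ℕ} → Graph n → Set
Acyclic {n} G = ∀ (x : Fin n) (xs : List (Fin n)) → Cycle G x xs → Data.Empty.⊥
  where import Data.Empty

IsTree : {n : ℕ} → Graph n → Set
IsTree G = Connected G × Acyclic G

degree : {n : ℕ} → Graph n → Fin n → ℕ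
degree G u = ∣ tabulate (adj G u) ∣

leaves : {n : ℕ} → Graph n → ℕ
leaves G = ∣ tabulate (λ u → degree G u ≡ᵇ 1) ∣

SpanningTree : {n : ℕ} → Graph n → Graph n → Set
SpanningTree {n} G T = (∀ u v → adj T u v ≡ true → adj G u v ≡ true) × IsTree T

ConnSetList : {n : ℕ} → Graph n → List (Subset n) → Set
ConnSetList {n} G L = Unique L × (∀ (S : Subset n) → (S LM.∈ L) ⇔ ConnectedSet G S)

-- a / b as a rational (convention: 0 when b = 0; never used with b = 0 here).
ratio : ℕ → ℕ → ℚ
ratio a zero    = 0ℚ
ratio a (suc b) = (+ a) / suc b

-- Connected set density computed from an enumeration L of the connected sets:
-- (average size of a connected set) / n = (Σ |S|) / (n · #sets).
density : {n : ℕ} → List (Subset n) → ℚ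
density {n} L = ratio (sum (map ∣_∣ L)) (n * length L)

module Submission where

-- H_n is a chain of n/6 copies of a six-vertex gadget, the exit of each copy joined to the entry
-- of the next. A connected set of a chain lies in its first copy, or in the rest of the chain, or
-- is a connected set of the first copy containing its exit glued to a connected set of the rest
-- containing its entry. This gives linear recurrences for the number of connected sets and for
-- the sum of their sizes, driven by four counts for the gadget (47 connected sets of total size
-- 147, 21 of total size 79 containing the exit, as many containing the entry, 9 of total size
-- 41 containing both). An invariant of these recurrences shows that 41/54 exceeds D(H_n) by at most
-- 150/(324 (n/6)). The chain of stars centred at vertex 1 of each copy is a spanning tree with
-- three leaves per copy plus the two ends, that is n/2 + 2 leaves.

module Graphs where

  open import Defs renaming (sym to adj-sym)
  open import Data.Nat using (ℕ; zero; suc; s≤s)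
  open import Data.Nat.Properties using (<-cmp; <-trans; <-irrefl)
  open import Data.Bool using (Bool; true; false; T; _∧_; _∨_)
  open import Data.Bool.Properties using (T-∧; T-∨; T-≡; ∨-comm)
  import Data.Bool.Properties as Bool
  open import Data.Bool.ListAction using (any)
  open import Data.Fin using (Fin; zero; suc; toℕ; _<_; _≟_)
  open import Data.Fin.Properties using (all?; toℕ-injective)
  open import Data.Fin.Subset using (Subset; _∈_) renaming (⊥ to ∅)
  open import Data.Fin.Subset.Properties using (_∈?_; nonempty?; ∉⊥)
  open import Data.Vec using ([]; _∷_; tabulate; lookup)
  open import Data.Vec.Properties using (lookup∘tabulate; ∷-injective)
  open import Data.List using (List; []; _∷_; [_]; allFin; filter; cartesianProductWith) renaming (_++_ to _++ˡ_)
  open import Data.List.Membership.Propositional using () renaming (_∈_ to _∈ˡ_; _∉_ to _∉ˡ_)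
  open import Data.List.Membership.Propositional.Properties
    using (∈-filter⁺; ∈-filter⁻; ∈-cartesianProductWith⁺)
  open import Data.List.Relation.Unary.Any using (here; there; satisfied)
  open import Data.List.Relation.Unary.Any.Properties using (any⁻)
  open import Data.List.Relation.Unary.All using ([]; _∷_)
  open import Data.List.Relation.Unary.AllPairs using ([]; _∷_)
  open import Data.List.Relation.Unary.Unique.Propositional using (Unique)
  import Data.List.Relation.Unary.Unique.Propositional.Properties as Unique
  open import Data.Product using (_×_; _,_; proj₂)
  open import Data.Sum using (_⊎_; inj₁; inj₂)
  open import Data.Unit using (⊤; tt)
  open import Data.Empty using (⊥; ⊥-elim)
  open import Function using (_∘_)
  open import Function.Bundles using (_⇔_; mk⇔; Equivalence)
  open import Level using (0ℓ)
  open import Relation.Nullary using (Dec; isYes)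
  open import Relation.Nullary.Decidable using (T?; toWitness; fromWitness; map′; _×-dec_; _→-dec_)
  open import Relation.Unary using (Pred; Decidable)
  open import Relation.Binary.Definitions using (tri<; tri≈; tri>)
  open import Relation.Binary.PropositionalEquality hiding ([_])

  undirected : ∀ {n} (E : Fin n → Fin n → Bool) → (∀ v → E v v ≡ false) → Graph n
  undirected E loopless = record
    { adj    = λ u v → E u v ∨ E v u
    ; sym    = λ u v → ∨-comm (E u v) (E v u)
    ; irrefl = λ v → cong₂ _∨_ (loopless v) (loopless v)
    }

  witness : ∀ {A : Set} (a? : Dec A) → isYes a? ≡ true → A
  witness a? = toWitness ∘ Equivalence.from T-≡

  module _ {n : ℕ} {G : Graph n} {S : Subset n} where

    PathIn-start : ∀ {u v} → PathIn G S u v → u ∈ S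
    PathIn-start (here u∈S)     = u∈S
    PathIn-start (step u∈S _ _) = u∈S

    PathIn-end : ∀ {u v} → PathIn G S u v → v ∈ S
    PathIn-end (here v∈S)    = v∈S
    PathIn-end (step _ _ uv) = PathIn-end uv

    _++ᵖ_ : ∀ {u v w} → PathIn G S u v → PathIn G S v w → PathIn G S u w
    here _        ++ᵖ vw = vw
    step u∈S e uv ++ᵖ vw = step u∈S e (uv ++ᵖ vw)

    PathIn-reverse : ∀ {u v} → PathIn G S u v → PathIn G S v u
    PathIn-reverse (here u∈S)       = here u∈S
    PathIn-reverse (step u∈S uw wv) =
      PathIn-reverse wv ++ᵖ step (PathIn-start wv) (trans (adj-sym G _ _) uw) (here u∈S)

    connectedSet-fromHub : ∀ {c} → c ∈ S → (∀ u → u ∈ S → PathIn G S u c) → ConnectedSet G S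
    connectedSet-fromHub {c} c∈S toHub =
      (c , c∈S) , λ u v u∈S v∈S → toHub u u∈S ++ᵖ PathIn-reverse (toHub v v∈S)

    connectedSet-nonempty : ConnectedSet G S → S ≢ ∅
    connectedSet-nonempty ((u , u∈S) , _) refl = ∉⊥ u∈S

  module Reachability {n : ℕ} (G : Graph n) (p : Subset n) where

    -- One round of backward search inside p. Stages are vectors rather than Boolean functions so
    -- that evaluation shares each stage instead of re-exploring exponentially many walks.
    expand : Subset n → Subset n
    expand R = tabulate λ w →
      lookup R w ∨ (isYes (w ∈? p) ∧ any (λ x → adj G w x ∧ lookup R x) (allFin n))

    reachable : ℕ → Fin n → Subset n
    reachable zero    v = tabulate λ w → isYes (w ∈? p) ∧ isYes (w ≟ v)
    reachable (suc t) v = expand (reachable t v)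

    reaches : ℕ → Fin n → Fin n → Bool
    reaches t w v = lookup (reachable t v) w

    reaches-sound : ∀ t {w v} → T (reaches t w v) → PathIn G p w v
    reaches-sound zero {w} {v} r with Equivalence.to (T-∧ {isYes (w ∈? p)}) (subst T (lookup∘tabulate _ w) r)
    ... | w∈p , w≡v =
      subst (PathIn G p w) (toWitness {a? = w ≟ v} w≡v) (here (toWitness {a? = w ∈? p} w∈p))
    reaches-sound (suc t) {w} {v} r with Equivalence.to (T-∨ {reaches t w v}) (subst T (lookup∘tabulate _ w) r)
    ... | inj₁ r′ = reaches-sound t r′
    ... | inj₂ r′ with Equivalence.to T-∧ r′
    ... | w∈p , any-x with satisfied (any⁻ _ (allFin n) any-x)
    ... | x , wx∧rx with Equivalence.to (T-∧ {adj G w x}) wx∧rx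
    ... | wx , rx = step (toWitness {a? = w ∈? p} w∈p) (Equivalence.to T-≡ wx) (reaches-sound t rx)

    reaches-refl : ∀ t {v} → v ∈ p → T (reaches t v v)
    reaches-refl zero {v} v∈p = subst T (sym (lookup∘tabulate _ v))
      (Equivalence.from T-∧ (fromWitness {a? = v ∈? p} v∈p , fromWitness {a? = v ≟ v} refl))
    reaches-refl (suc t) {v} v∈p = subst T (sym (lookup∘tabulate _ v))
      (Equivalence.from T-∨ (inj₁ (reaches-refl t v∈p)))

    ClosedUnder : (Fin n → Bool) → Set
    ClosedUnder R = ∀ x y → x ∈ p → adj G x y ≡ true → T (R y) → T (R x)

    closedUnder? : ∀ R → Dec (ClosedUnder R)
    closedUnder? R = all? λ x → all? λ y →
      x ∈? p →-dec adj G x y Bool.≟ true →-dec T? (R y) →-dec T? (R x)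

    closedUnder-path : ∀ {R u v} → ClosedUnder R → T (R v) → PathIn G p u v → T (R u)
    closedUnder-path closed Rv (here _)         = Rv
    closedUnder-path closed Rv (step u∈p uw wv) =
      closed _ _ u∈p uw (closedUnder-path closed Rv wv)

    -- Completeness of `reaches n` is not proved in general: it follows from closure under the
    -- edges of G[p], a decidable property that is checked by evaluation for the concrete graphs.
    ReachClosed : Set
    ReachClosed = ∀ v → ClosedUnder (λ w → reaches n w v)

    reachClosed? : Dec ReachClosed
    reachClosed? = all? λ v → closedUnder? (λ w → reaches n w v)

    path? : ReachClosed → ∀ u v → Dec (PathIn G p u v)
    path? closed u v = map′ (reaches-sound n) complete (T? (reaches n u v))
      where
      complete : PathIn G p u v → T (reaches n u v)
      complete uv = closedUnder-path (closed v) (reaches-refl n (PathIn-end uv)) uv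

    connectedSet? : ReachClosed → Dec (ConnectedSet G p)
    connectedSet? closed = nonempty? p ×-dec all? λ u → all? λ v →
      u ∈? p →-dec v ∈? p →-dec path? closed u v

  subsets : ∀ n → List (Subset n)
  subsets zero    = [ [] ]
  subsets (suc n) = cartesianProductWith _∷_ (true ∷ false ∷ []) (subsets n)

  ∈-subsets : ∀ {n} (p : Subset n) → p ∈ˡ subsets n
  ∈-subsets []          = here refl
  ∈-subsets (true ∷ p)  = ∈-cartesianProductWith⁺ _∷_ {xs = true ∷ false ∷ []} (here refl) (∈-subsets p)
  ∈-subsets (false ∷ p) =
    ∈-cartesianProductWith⁺ _∷_ {xs = true ∷ false ∷ []} (there (here refl)) (∈-subsets p)

  subsets-unique : ∀ n → Unique (subsets n)
  subsets-unique zero    = [] ∷ []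
  subsets-unique (suc n) = Unique.cartesianProductWith⁺ _∷_ ∷-injective booleans-unique (subsets-unique n)
    where
    booleans-unique : Unique (true ∷ false ∷ [])
    booleans-unique = ((λ ()) ∷ []) ∷ [] ∷ []

  module _ {n : ℕ} {P : Pred (Subset n) 0ℓ} (P? : Decidable P) where

    enumerate : List (Subset n)
    enumerate = filter P? (subsets n)

    enumerate-unique : Unique enumerate
    enumerate-unique = Unique.filter⁺ P? (subsets-unique n)

    ∈-enumerate : ∀ {p} → p ∈ˡ enumerate ⇔ P p
    ∈-enumerate {p} = mk⇔ (proj₂ ∘ ∈-filter⁻ P? {xs = subsets n}) (∈-filter⁺ P? (∈-subsets p))

  AtMostOneLowerNeighbour : ∀ {n} → Graph n → Set
  AtMostOneLowerNeighbour G =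
    ∀ u v w → adj G u v ≡ true → adj G u w ≡ true → v < u → w < u → v ≡ w

  module _ {n : ℕ} (G : Graph n) (lower-unique : AtMostOneLowerNeighbour G) where

    private
      Walk : List (Fin n) → Set
      Walk (a ∷ b ∷ t) = adj G a b ≡ true × Walk (b ∷ t)
      Walk _           = ⊤

      NonBacktracking : List (Fin n) → Set
      NonBacktracking (a ∷ b ∷ c ∷ t) = a ≢ c × NonBacktracking (b ∷ c ∷ t)
      NonBacktracking _               = ⊤

      EndsDescending : List (Fin n) → Set
      EndsDescending (a ∷ b ∷ [])    = b < a
      EndsDescending (a ∷ b ∷ c ∷ t) = EndsDescending (b ∷ c ∷ t)
      EndsDescending _               = ⊤

      last : Fin n → List (Fin n) → Fin n
      last a []      = a
      last a (b ∷ t) = last b t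

      adjacent-comparable : ∀ {a b} → adj G a b ≡ true → a < b ⊎ b < a
      adjacent-comparable {a} {b} e with <-cmp (toℕ a) (toℕ b)
      ... | tri< a<b _ _ = inj₁ a<b
      ... | tri> _ _ b<a = inj₂ b<a
      ... | tri≈ _ a≡b _ with toℕ-injective a≡b
      ...   | refl with trans (sym e) (irrefl G a)
      ...     | ()

      flip : ∀ {a b} → adj G a b ≡ true → adj G b a ≡ true
      flip {a} {b} e = trans (adj-sym G b a) e

      ascending : ∀ a b t → Walk (a ∷ b ∷ t) → NonBacktracking (a ∷ b ∷ t) → a < b → a < last b t
      ascending a b []      _                  _            a<b = a<b
      ascending a b (c ∷ t) (ab , bc , walk) (a≢c , nb) a<b with adjacent-comparable bc
      ... | inj₁ b<c = <-trans a<b (ascending b c t (bc , walk) nb b<c)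
      ... | inj₂ c<b = ⊥-elim (a≢c (lower-unique b a c (flip ab) bc a<b c<b))

      descending : ∀ a b t → Walk (a ∷ b ∷ t) → NonBacktracking (a ∷ b ∷ t) →
                   EndsDescending (a ∷ b ∷ t) → b < a × last b t < a
      descending a b []      _                  _            d = d , d
      descending a b (c ∷ t) (ab , bc , walk) (a≢c , nb) d with descending b c t (bc , walk) nb d
      ... | c<b , l<b with adjacent-comparable ab
      ...   | inj₂ b<a = b<a , <-trans l<b b<a
      ...   | inj₁ a<b = ⊥-elim (a≢c (lower-unique b a c (flip ab) bc a<b c<b))

      linked⇒walk : ∀ a ws b → Linked G a ws b → Walk (a ∷ ws ++ˡ [ b ])
      linked⇒walk a []       b ab         = ab , tt
      linked⇒walk a (w ∷ ws) b (aw , wb) = aw , linked⇒walk w ws b wb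

      linked-last : ∀ a ws b → Linked G a ws b → adj G (last a ws) b ≡ true
      linked-last a []       b ab       = ab
      linked-last a (w ∷ ws) b (_ , wb) = linked-last w ws b wb

      last-snoc : ∀ a ws x → last a (ws ++ˡ [ x ]) ≡ x
      last-snoc a []       x = refl
      last-snoc a (w ∷ ws) x = last-snoc w ws x

      endsDescending-snoc : ∀ a ws x → x < last a ws → EndsDescending (a ∷ ws ++ˡ [ x ])
      endsDescending-snoc a []            x d = d
      endsDescending-snoc a (w ∷ [])      x d = d
      endsDescending-snoc a (w ∷ w′ ∷ ws) x d = endsDescending-snoc w (w′ ∷ ws) x d

      last-∈ : ∀ a ws → last a ws ∈ˡ a ∷ ws
      last-∈ a []       = here refl
      last-∈ a (w ∷ ws) = there (last-∈ w ws)

      unique⇒nonBacktracking : ∀ a b ws x → Unique (a ∷ b ∷ ws) → x ∉ˡ (a ∷ b ∷ ws) →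
                               NonBacktracking (a ∷ b ∷ ws ++ˡ [ x ])
      unique⇒nonBacktracking a b []       x _                     x∉ = (λ a≡x → x∉ (here (sym a≡x))) , tt
      unique⇒nonBacktracking a b (c ∷ ws) x ((_ ∷ a≢c ∷ _) ∷ u) x∉ =
        a≢c , unique⇒nonBacktracking b c ws x u (x∉ ∘ there)

    atMostOneLowerNeighbour⇒acyclic : Acyclic G
    atMostOneLowerNeighbour⇒acyclic x []           (() , _)
    atMostOneLowerNeighbour⇒acyclic x (_ ∷ [])     (s≤s () , _)
    atMostOneLowerNeighbour⇒acyclic x (w₁ ∷ w₂ ∷ ws) (_ , u@((_ ∷ x≢w₂ ∷ _) ∷ u′) , linked)
      with linked⇒walk x (w₁ ∷ w₂ ∷ ws) x linked
    ... | walk@(xw₁ , _) = contradiction (adjacent-comparable xw₁)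
      where
      closing : adj G (last w₂ ws) x ≡ true
      closing = linked-last x (w₁ ∷ w₂ ∷ ws) x linked

      nb : NonBacktracking (x ∷ w₁ ∷ w₂ ∷ ws ++ˡ [ x ])
      nb = x≢w₂ , unique⇒nonBacktracking w₁ w₂ ws x u′ (Unique.Unique[x∷xs]⇒x∉xs u)

      contradiction : x < w₁ ⊎ w₁ < x → ⊥
      contradiction (inj₁ x<w₁) = <-irrefl refl
        (subst (x <_) (last-snoc w₂ ws x) (ascending x w₁ (w₂ ∷ ws ++ˡ [ x ]) walk nb x<w₁))
      contradiction (inj₂ w₁<x) with adjacent-comparable closing
      ... | inj₁ l<x = Unique.Unique[x∷xs]⇒x∉xs u′ (subst (_∈ˡ w₂ ∷ ws)
        (sym (lower-unique x w₁ (last w₂ ws) xw₁ (flip closing) w₁<x l<x)) (last-∈ w₂ ws))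
      ... | inj₂ x<l = <-irrefl refl (subst (_< x) (last-snoc w₂ ws x) (proj₂
        (descending x w₁ (w₂ ∷ ws ++ˡ [ x ]) walk nb (endsDescending-snoc x (w₁ ∷ w₂ ∷ ws) x x<l))))

module Chains where

  open import Defs renaming (sym to adj-sym)
  open import Data.Nat as ℕ using (ℕ; zero; suc; _+_; _*_; _≡ᵇ_)
  open import Data.Nat.Properties
    using (+-identityʳ; *-zeroʳ; +-cancelˡ-<; m≤m+n; <-irrefl; n≮0; module ≤-Reasoning)
  open import Data.Nat.Tactic.RingSolver using (solve-∀)
  open import Data.Nat.ListAction using (sum)
  open import Data.Nat.ListAction.Properties using (sum-++)
  open import Data.Bool using (Bool; true; false; _∧_; if_then_else_)
  open import Data.Bool.Properties using (∧-comm)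
  open import Data.Fin using (Fin; zero; suc; toℕ; _<_; _↑ˡ_; _↑ʳ_; splitAt; _≟_)
  open import Data.Fin.Properties
    using (splitAt-↑ˡ; splitAt-↑ʳ; ↑ˡ-injective; ↑ʳ-injective; toℕ-↑ˡ; toℕ-↑ʳ; toℕ<n)
  open import Data.Fin.Subset using (Subset; _∈_; ∣_∣; Nonempty; inside; outside) renaming (⊥ to ∅)
  open import Data.Fin.Subset.Properties using (_∈?_; nonempty?; Empty-unique; ∉⊥; ∣⊥∣≡0)
  open import Data.Vec using ([]; _∷_; _++_; here; there; tabulate)
  import Data.Vec as Vec
  open import Data.Vec.Properties
    using (tabulate-cong; lookup∘tabulate; lookup⇒[]=; ++-injective; ++-injectiveˡ; ++-injectiveʳ)
  open import Data.List using (List; []; _∷_; map; length; cartesianProductWith) renaming (_++_ to _++ˡ_)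
  open import Data.List.Properties using (length-++; length-map; map-++)
  open import Data.List.Membership.Propositional using () renaming (_∈_ to _∈ˡ_)
  import Data.List.Membership.Propositional.Properties as ∈ˡ
  open import Data.List.Relation.Unary.Unique.Propositional using (Unique)
  open import Data.List.Relation.Unary.AllPairs using ([])
  import Data.List.Relation.Unary.Unique.Propositional.Properties as Unique
  open import Data.Product using (Σ; _×_; _,_; proj₁; proj₂)
  open import Data.Sum using (_⊎_; inj₁; inj₂)
  open import Data.Empty using (⊥; ⊥-elim)
  open import Function using (_∘_)
  open import Function.Bundles using (_⇔_; mk⇔; module Equivalence)
  open Equivalence using (to; from)
  open import Relation.Nullary using (¬_; does; yes; no)
  open import Relation.Nullary.Decidable using (dec-true; _×-dec_)
  open import Relation.Unary using (Decidable)
  open import Relation.Binary.PropositionalEquality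
  open Graphs

  ∧-≡-true : ∀ {a b} → a ∧ b ≡ true → a ≡ true × b ≡ true
  ∧-≡-true {true} {true} _ = refl , refl

  isZero : ∀ {n} → Fin n → Bool
  isZero zero    = true
  isZero (suc _) = false

  isZero-unique : ∀ {n} {a b : Fin n} → isZero a ≡ true → isZero b ≡ true → a ≡ b
  isZero-unique {a = zero} {zero} _ _ = refl

  ∈-++⁺ˡ : ∀ {m n} {p : Subset m} {q : Subset n} {i} → i ∈ p → (i ↑ˡ n) ∈ (p ++ q)
  ∈-++⁺ˡ here        = here
  ∈-++⁺ˡ (there i∈p) = there (∈-++⁺ˡ i∈p)

  ∈-++⁺ʳ : ∀ {m n} (p : Subset m) {q : Subset n} {j} → j ∈ q → (m ↑ʳ j) ∈ (p ++ q)
  ∈-++⁺ʳ []      j∈q = j∈q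
  ∈-++⁺ʳ (_ ∷ p) j∈q = there (∈-++⁺ʳ p j∈q)

  ∈-++⁻ˡ : ∀ {m n} (p : Subset m) {q : Subset n} {i} → (i ↑ˡ n) ∈ (p ++ q) → i ∈ p
  ∈-++⁻ˡ (_ ∷ p) {i = zero}  here         = here
  ∈-++⁻ˡ (_ ∷ p) {i = suc i} (there i∈pq) = there (∈-++⁻ˡ p i∈pq)

  ∈-++⁻ʳ : ∀ {m n} (p : Subset m) {q : Subset n} {j} → (m ↑ʳ j) ∈ (p ++ q) → j ∈ q
  ∈-++⁻ʳ []      j∈q          = j∈q
  ∈-++⁻ʳ (_ ∷ p) (there j∈pq) = ∈-++⁻ʳ p j∈pq

  data Split (m n : ℕ) : Fin (m + n) → Set where
    left  : (i : Fin m) → Split m n (i ↑ˡ n)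
    right : (j : Fin n) → Split m n (m ↑ʳ j)

  split : ∀ m {n} (u : Fin (m + n)) → Split m n u
  split zero    u       = right u
  split (suc m) zero    = left zero
  split (suc m) (suc u) with split m u
  ... | left i  = left (suc i)
  ... | right j = right j

  split-↑ˡ : ∀ m {n} (i : Fin m) → split m {n} (i ↑ˡ n) ≡ left i
  split-↑ˡ (suc m)     zero    = refl
  split-↑ˡ (suc m) {n} (suc i) rewrite split-↑ˡ m {n} i = refl

  split-↑ʳ : ∀ m {n} (j : Fin n) → split m (m ↑ʳ j) ≡ right j
  split-↑ʳ zero    j = refl
  split-↑ʳ (suc m) j rewrite split-↑ʳ m j = refl

  ↑ˡ≢↑ʳ : ∀ {m n} (i : Fin m) (j : Fin n) → i ↑ˡ n ≢ m ↑ʳ j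
  ↑ˡ≢↑ʳ {m} {n} i j eq
    with trans (sym (splitAt-↑ˡ m i n)) (trans (cong (splitAt m) eq) (splitAt-↑ʳ m n j))
  ... | ()

  ∣tabulate∣-++ : ∀ m {n} (f : Fin (m + n) → Bool) →
                  ∣ tabulate f ∣ ≡ ∣ tabulate (f ∘ (_↑ˡ n)) ∣ + ∣ tabulate (f ∘ (m ↑ʳ_)) ∣
  ∣tabulate∣-++ zero    f = refl
  ∣tabulate∣-++ (suc m) f with f zero
  ... | true  = cong suc (∣tabulate∣-++ m (f ∘ suc))
  ... | false = ∣tabulate∣-++ m (f ∘ suc)

  ∣tabulate-false∣ : ∀ n → ∣ tabulate {n = n} (λ _ → false) ∣ ≡ 0
  ∣tabulate-false∣ zero    = refl
  ∣tabulate-false∣ (suc n) = ∣tabulate-false∣ n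

  ∣tabulate-≟∣ : ∀ {n} (x : Fin n) → ∣ tabulate (λ j → does (j ≟ x)) ∣ ≡ 1
  ∣tabulate-≟∣ {suc n} zero    = cong suc (∣tabulate-false∣ n)
  ∣tabulate-≟∣ {suc n} (suc x) = ∣tabulate-≟∣ {n} x

  ∣tabulate∣-head-true : ∀ {n} (f : Fin (suc n) → Bool) → f zero ≡ true →
                         ∣ tabulate f ∣ ≡ suc ∣ tabulate (f ∘ suc) ∣
  ∣tabulate∣-head-true f e rewrite e = refl

  ∣tabulate∣-head-false : ∀ {n} (f : Fin (suc n) → Bool) → f zero ≡ false →
                          ∣ tabulate f ∣ ≡ ∣ tabulate (f ∘ suc) ∣
  ∣tabulate∣-head-false f e rewrite e = refl

  full-++ : ∀ m n → full (m + n) ≡ full m ++ full n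
  full-++ zero    n = refl
  full-++ (suc m) n = cong (true ∷_) (full-++ m n)

  ∈-full : ∀ {n} (x : Fin n) → x ∈ full n
  ∈-full {n} x = lookup⇒[]= x (full n) (lookup∘tabulate _ x)

  weight : ∀ {n} → List (Subset n) → ℕ
  weight L = sum (map ∣_∣ L)

  ∣p++q∣ : ∀ {m n} (p : Subset m) (q : Subset n) → ∣ p ++ q ∣ ≡ ∣ p ∣ + ∣ q ∣
  ∣p++q∣ []            q = refl
  ∣p++q∣ (inside ∷ p)  q = cong suc (∣p++q∣ p q)
  ∣p++q∣ (outside ∷ p) q = ∣p++q∣ p q

  weight-++ : ∀ {n} (xs ys : List (Subset n)) → weight (xs ++ˡ ys) ≡ weight xs + weight ys
  weight-++ xs ys = trans (cong sum (map-++ ∣_∣ xs ys)) (sum-++ (map ∣_∣ xs) (map ∣_∣ ys))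

  weight-map-++∅ : ∀ {m n} (xs : List (Subset m)) → weight (map (_++ ∅ {n}) xs) ≡ weight xs
  weight-map-++∅         []       = refl
  weight-map-++∅ {n = n} (p ∷ xs) = cong₂ _+_
    (trans (∣p++q∣ p ∅) (trans (cong (∣ p ∣ +_) (∣⊥∣≡0 n)) (+-identityʳ ∣ p ∣)))
    (weight-map-++∅ xs)

  weight-map-p++ : ∀ {m n} (p : Subset m) (ys : List (Subset n)) →
                   weight (map (p ++_) ys) ≡ ∣ p ∣ * length ys + weight ys
  weight-map-p++ p []       = sym (trans (+-identityʳ (∣ p ∣ * 0)) (*-zeroʳ ∣ p ∣))
  weight-map-p++ p (q ∷ ys) = begin
    ∣ p ++ q ∣ + weight (map (p ++_) ys)
      ≡⟨ cong₂ _+_ (∣p++q∣ p q) (weight-map-p++ p ys) ⟩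
    (∣ p ∣ + ∣ q ∣) + (∣ p ∣ * length ys + weight ys)
      ≡⟨ rearrange ∣ p ∣ ∣ q ∣ (length ys) (weight ys) ⟩
    ∣ p ∣ * suc (length ys) + (∣ q ∣ + weight ys)
      ∎
    where
    open ≡-Reasoning
    rearrange : ∀ a b l w → (a + b) + (a * l + w) ≡ a * suc l + (b + w)
    rearrange = solve-∀

  weight-map-∅++ : ∀ {m n} (ys : List (Subset n)) → weight (map (∅ {m} ++_) ys) ≡ weight ys
  weight-map-∅++ {m} ys =
    trans (weight-map-p++ ∅ ys) (cong (λ s → s * length ys + weight ys) (∣⊥∣≡0 m))

  length-cartesianProductWith : ∀ {A B C : Set} (f : A → B → C) xs ys →
    length (cartesianProductWith f xs ys) ≡ length xs * length ys
  length-cartesianProductWith f []       ys = refl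
  length-cartesianProductWith f (x ∷ xs) ys = trans (length-++ (map (f x) ys))
    (cong₂ _+_ (length-map (f x) ys) (length-cartesianProductWith f xs ys))

  weight-cartesianProduct : ∀ {m n} (xs : List (Subset m)) (ys : List (Subset n)) →
    weight (cartesianProductWith _++_ xs ys) ≡ weight xs * length ys + length xs * weight ys
  weight-cartesianProduct []       ys = refl
  weight-cartesianProduct (p ∷ xs) ys = begin
    weight (map (p ++_) ys ++ˡ cartesianProductWith _++_ xs ys)
      ≡⟨ weight-++ (map (p ++_) ys) _ ⟩
    weight (map (p ++_) ys) + weight (cartesianProductWith _++_ xs ys)
      ≡⟨ cong₂ _+_ (weight-map-p++ p ys) (weight-cartesianProduct xs ys) ⟩
    (∣ p ∣ * length ys + weight ys) + (weight xs * length ys + length xs * weight ys)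
      ≡⟨ rearrange ∣ p ∣ (weight xs) (length xs) (length ys) (weight ys) ⟩
    (∣ p ∣ + weight xs) * length ys + suc (length xs) * weight ys
      ∎
    where
    open ≡-Reasoning
    rearrange : ∀ a w l ℓ v → (a * ℓ + v) + (w * ℓ + l * v) ≡ (a + w) * ℓ + suc l * v
    rearrange = solve-∀

  -- chain m places m copies of γ side by side on Fin (m * k) and joins the exit of each copy to
  -- vertex zero, the entry, of the next one.
  module Chain {g : ℕ} (γ : Graph (suc g)) (exit : Fin (suc g)) where

    private
      k = suc g

    isExit : Fin k → Bool
    isExit i = does (i ≟ exit)

    isExit-sound : ∀ {i} → isExit i ≡ true → i ≡ exit
    isExit-sound {i} e with i ≟ exit
    ... | yes i≡exit = i≡exit

    isExit-exit : isExit exit ≡ true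
    isExit-exit = dec-true (exit ≟ exit) refl

    link : ∀ {n} → (Fin n → Fin n → Bool) → Fin k ⊎ Fin n → Fin k ⊎ Fin n → Bool
    link A (inj₁ a) (inj₁ b) = adj γ a b
    link A (inj₁ a) (inj₂ j) = isExit a ∧ isZero j
    link A (inj₂ i) (inj₁ b) = isZero i ∧ isExit b
    link A (inj₂ i) (inj₂ j) = A i j

    chainAdj : ∀ m → Fin (m * k) → Fin (m * k) → Bool
    chainAdj (suc m) u v = link (chainAdj m) (splitAt k u) (splitAt k v)

    chainAdj-sym : ∀ m u v → chainAdj m u v ≡ chainAdj m v u
    chainAdj-sym (suc m) u v with splitAt k u | splitAt k v
    ... | inj₁ a | inj₁ b = adj-sym γ a b
    ... | inj₁ a | inj₂ j = ∧-comm (isExit a) (isZero j)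
    ... | inj₂ i | inj₁ b = ∧-comm (isZero i) (isExit b)
    ... | inj₂ i | inj₂ j = chainAdj-sym m i j

    chainAdj-irrefl : ∀ m v → chainAdj m v v ≡ false
    chainAdj-irrefl (suc m) v with splitAt k v
    ... | inj₁ a = irrefl γ a
    ... | inj₂ j = chainAdj-irrefl m j

    chain : ∀ m → Graph (m * k)
    chain m = record { adj = chainAdj m ; sym = chainAdj-sym m ; irrefl = chainAdj-irrefl m }

    module _ (m : ℕ) where

      adj-↑ˡ↑ˡ : ∀ i j → chainAdj (suc m) (i ↑ˡ m * k) (j ↑ˡ m * k) ≡ adj γ i j
      adj-↑ˡ↑ˡ i j rewrite splitAt-↑ˡ k i (m * k) | splitAt-↑ˡ k j (m * k) = refl

      adj-↑ˡ↑ʳ : ∀ i b → chainAdj (suc m) (i ↑ˡ m * k) (k ↑ʳ b) ≡ isExit i ∧ isZero b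
      adj-↑ˡ↑ʳ i b rewrite splitAt-↑ˡ k i (m * k) | splitAt-↑ʳ k (m * k) b = refl

      adj-↑ʳ↑ˡ : ∀ a j → chainAdj (suc m) (k ↑ʳ a) (j ↑ˡ m * k) ≡ isZero a ∧ isExit j
      adj-↑ʳ↑ˡ a j rewrite splitAt-↑ʳ k (m * k) a | splitAt-↑ˡ k j (m * k) = refl

      adj-↑ʳ↑ʳ : ∀ a b → chainAdj (suc m) (k ↑ʳ a) (k ↑ʳ b) ≡ chainAdj m a b
      adj-↑ʳ↑ʳ a b rewrite splitAt-↑ʳ k (m * k) a | splitAt-↑ʳ k (m * k) b = refl

      crossing-↑ˡ↑ʳ : ∀ i b → chainAdj (suc m) (i ↑ˡ m * k) (k ↑ʳ b) ≡ true →
                      i ≡ exit × isZero b ≡ true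
      crossing-↑ˡ↑ʳ i b e with ∧-≡-true (trans (sym (adj-↑ˡ↑ʳ i b)) e)
      ... | x , e₀ = isExit-sound x , e₀

      crossing-↑ʳ↑ˡ : ∀ a j → chainAdj (suc m) (k ↑ʳ a) (j ↑ˡ m * k) ≡ true →
                      isZero a ≡ true × j ≡ exit
      crossing-↑ʳ↑ˡ a j e with ∧-≡-true (trans (sym (adj-↑ʳ↑ˡ a j)) e)
      ... | e₀ , x = e₀ , isExit-sound x

    ContainsEntry : ∀ m → Subset (m * k) → Set
    ContainsEntry m R = Σ (Fin (m * k)) λ e → isZero e ≡ true × e ∈ R

    Rooted : ∀ m → Subset (m * k) → Set
    Rooted m R = ConnectedSet (chain m) R × ContainsEntry m R

    -- Subsets of chain (suc m) are written p ++ R, with p in the first copy and R in the rest.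
    module Glue (m : ℕ) (p : Subset k) (R : Subset (m * k)) where

      private
        G = chain (suc m)
        S = p ++ R
        n = m * k

      liftˡ : ∀ {i j} → PathIn γ p i j → PathIn G S (i ↑ˡ n) (j ↑ˡ n)
      liftˡ (here i∈p)                = here (∈-++⁺ˡ i∈p)
      liftˡ (step {w = w} i∈p e wj) = step (∈-++⁺ˡ i∈p) (trans (adj-↑ˡ↑ˡ m _ w) e) (liftˡ wj)

      liftʳ : ∀ {a b} → PathIn (chain m) R a b → PathIn G S (k ↑ʳ a) (k ↑ʳ b)
      liftʳ (here a∈R)                = here (∈-++⁺ʳ p a∈R)
      liftʳ (step {w = w} a∈R e wb) = step (∈-++⁺ʳ p a∈R) (trans (adj-↑ʳ↑ʳ m _ w) e) (liftʳ wb)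

      bridge : ∀ {e} → exit ∈ p → isZero e ≡ true → e ∈ R → PathIn G S (k ↑ʳ e) (exit ↑ˡ n)
      bridge {e} x∈p e₀ e∈R = step (∈-++⁺ʳ p e∈R)
        (trans (adj-↑ʳ↑ˡ m e exit) (cong₂ _∧_ e₀ isExit-exit)) (here (∈-++⁺ˡ x∈p))

      connected-first : ConnectedSet γ p → R ≡ ∅ → ConnectedSet G S
      connected-first ((c , c∈p) , paths) refl = connectedSet-fromHub (∈-++⁺ˡ c∈p) toHub
        where
        toHub : ∀ u → u ∈ S → PathIn G S u (c ↑ˡ n)
        toHub u u∈S with split k u
        ... | left i  = liftˡ (paths i c (∈-++⁻ˡ p u∈S) c∈p)
        ... | right a = ⊥-elim (∉⊥ (∈-++⁻ʳ p u∈S))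

      connected-rest : p ≡ ∅ → ConnectedSet (chain m) R → ConnectedSet G S
      connected-rest refl ((c , c∈R) , paths) = connectedSet-fromHub (∈-++⁺ʳ p c∈R) toHub
        where
        toHub : ∀ u → u ∈ S → PathIn G S u (k ↑ʳ c)
        toHub u u∈S with split k u
        ... | left i  = ⊥-elim (∉⊥ (∈-++⁻ˡ p u∈S))
        ... | right a = liftʳ (paths a c (∈-++⁻ʳ p u∈S) c∈R)

      connected-across : ConnectedSet γ p → exit ∈ p → Rooted m R → ConnectedSet G S
      connected-across (_ , pathsˡ) x∈p ((_ , pathsʳ) , e , e₀ , e∈R) =
        connectedSet-fromHub (∈-++⁺ˡ x∈p) toHub
        where
        toHub : ∀ u → u ∈ S → PathIn G S u (exit ↑ˡ n)
        toHub u u∈S with split k u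
        ... | left i  = liftˡ (pathsˡ i exit (∈-++⁻ˡ p u∈S) x∈p)
        ... | right a = liftʳ (pathsʳ a e (∈-++⁻ʳ p u∈S) e∈R) ++ᵖ bridge x∈p e₀ e∈R

      -- Projections of walks: the only edge between the first copy and the rest joins its exit to
      -- the entry of the rest, so a walk changing sides passes through both.
      FirstView : ∀ {w} → Split k n w → Fin k → Set
      FirstView (left i)  j = PathIn γ p i j
      FirstView (right _) j = exit ∈ p × PathIn γ p exit j

      project-first : ∀ {w t} → PathIn G S w t → ∀ j → t ≡ j ↑ˡ n → FirstView (split k w) j
      project-first {w} (here w∈S) j eq with split k w
      ... | left i  rewrite ↑ˡ-injective n i j eq = here (∈-++⁻ˡ p w∈S)
      ... | right a = ⊥-elim (↑ˡ≢↑ʳ j a (sym eq))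
      project-first {w} (step {w = x} w∈S e xt) j eq with split k w | split k x | project-first xt j eq
      ... | left i  | left i′ | ih        = step (∈-++⁻ˡ p w∈S) (trans (sym (adj-↑ˡ↑ˡ m i i′)) e) ih
      ... | left i  | right a | _ , ih    =
        subst (λ v → PathIn γ p v j) (sym (proj₁ (crossing-↑ˡ↑ʳ m i a e))) ih
      ... | right a | left i′ | ih        =
        subst (λ v → v ∈ p × PathIn γ p v j) (proj₂ (crossing-↑ʳ↑ˡ m a i′ e)) (PathIn-start ih , ih)
      ... | right a | right b | ih        = ih

      RestView : ∀ {w} → Split k n w → Fin n → Set
      RestView (left _)  b = Σ (Fin n) λ e → isZero e ≡ true × PathIn (chain m) R e b
      RestView (right a) b = PathIn (chain m) R a b

      project-rest : ∀ {w t} → PathIn G S w t → ∀ b → t ≡ k ↑ʳ b → RestView (split k w) b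
      project-rest {w} (here w∈S) b eq with split k w
      ... | left i  = ⊥-elim (↑ˡ≢↑ʳ i b eq)
      ... | right a rewrite ↑ʳ-injective k a b eq = here (∈-++⁻ʳ p w∈S)
      project-rest {w} (step {w = x} w∈S e xt) b eq with split k w | split k x | project-rest xt b eq
      ... | left i  | left i′ | ih             = ih
      ... | left i  | right a | ih             = a , proj₂ (crossing-↑ˡ↑ʳ m i a e) , ih
      ... | right a | left i′ | a′ , a′₀ , ih  =
        subst (λ v → PathIn (chain m) R v b) (isZero-unique a′₀ (proj₁ (crossing-↑ʳ↑ˡ m a i′ e))) ih
      ... | right a | right a′ | ih            =
        step (∈-++⁻ʳ p w∈S) (trans (sym (adj-↑ʳ↑ʳ m a a′)) e) ih

      connected-first⁻ : Nonempty p → ConnectedSet G S → ConnectedSet γ p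
      connected-first⁻ ne (_ , paths) = ne , λ i j i∈p j∈p →
        subst (λ v → FirstView v j) (split-↑ˡ k i)
          (project-first (paths _ _ (∈-++⁺ˡ i∈p) (∈-++⁺ˡ j∈p)) j refl)

      connected-rest⁻ : Nonempty R → ConnectedSet G S → ConnectedSet (chain m) R
      connected-rest⁻ ne (_ , paths) = ne , λ a b a∈R b∈R →
        subst (λ v → RestView v b) (split-↑ʳ k a)
          (project-rest (paths _ _ (∈-++⁺ʳ p a∈R) (∈-++⁺ʳ p b∈R)) b refl)

      data Decomposition : Set where
        first  : ConnectedSet γ p → R ≡ ∅ → Decomposition
        rest   : p ≡ ∅ → ConnectedSet (chain m) R → Decomposition
        across : ConnectedSet γ p → exit ∈ p → Rooted m R → Decomposition

      decompose : ConnectedSet G S → Decomposition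
      decompose cs with nonempty? p | nonempty? R
      ... | yes p≢∅ | no  R≡∅ = first (connected-first⁻ p≢∅ cs) (Empty-unique R≡∅)
      ... | no  p≡∅ | yes R≢∅ = rest (Empty-unique p≡∅) (connected-rest⁻ R≢∅ cs)
      ... | no  p≡∅ | no  R≡∅ with proj₁ cs
      ...   | u , u∈S with split k u
      ...     | left i  = ⊥-elim (p≡∅ (i , ∈-++⁻ˡ p u∈S))
      ...     | right a = ⊥-elim (R≡∅ (a , ∈-++⁻ʳ p u∈S))
      decompose cs@(_ , paths) | yes (i , i∈p) | yes (a , a∈R) =
        across (connected-first⁻ (i , i∈p) cs) exit∈p (connected-rest⁻ (a , a∈R) cs , entry)
        where
        exit∈p : exit ∈ p
        exit∈p = proj₁ (subst (λ v → FirstView v i) (split-↑ʳ k a)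
          (project-first (paths _ _ (∈-++⁺ʳ p a∈R) (∈-++⁺ˡ i∈p)) i refl))
        entry : ContainsEntry m R
        entry with subst (λ v → RestView v a) (split-↑ˡ k i)
                     (project-rest (paths _ _ (∈-++⁺ˡ i∈p) (∈-++⁺ʳ p a∈R)) a refl)
        ... | e , e₀ , ea = e , e₀ , PathIn-start ea

      rooted-first : ConnectedSet γ p → zero ∈ p → R ≡ ∅ → Rooted (suc m) S
      rooted-first cs z∈p R≡∅ = connected-first cs R≡∅ , zero , refl , ∈-++⁺ˡ z∈p

      rooted-across : ConnectedSet γ p → zero ∈ p → exit ∈ p → Rooted m R → Rooted (suc m) S
      rooted-across cs z∈p x∈p rooted = connected-across cs x∈p rooted , zero , refl , ∈-++⁺ˡ z∈p

      data RootedDecomposition : Set where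
        first  : ConnectedSet γ p → zero ∈ p → R ≡ ∅ → RootedDecomposition
        across : ConnectedSet γ p → zero ∈ p → exit ∈ p → Rooted m R → RootedDecomposition

      decompose-rooted : Rooted (suc m) S → RootedDecomposition
      decompose-rooted (cs , zero , _ , z∈S) with decompose cs
      ... | first c R≡∅      = first c (∈-++⁻ˡ p z∈S) R≡∅
      ... | rest p≡∅ _       = ⊥-elim (∉⊥ (subst (zero ∈_) p≡∅ (∈-++⁻ˡ p z∈S)))
      ... | across c x∈p r   = across c (∈-++⁻ˡ p z∈S) x∈p r

    module Enumeration (connected? : Decidable (ConnectedSet γ)) where

      connectedWithExit? : Decidable (λ p → ConnectedSet γ p × exit ∈ p)
      connectedWithExit? p = connected? p ×-dec exit ∈? p

      connectedWithEntry? : Decidable (λ p → ConnectedSet γ p × zero ∈ p)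
      connectedWithEntry? p = connected? p ×-dec zero ∈? p

      connectedThrough? : Decidable (λ p → ConnectedSet γ p × zero ∈ p × exit ∈ p)
      connectedThrough? p = connected? p ×-dec zero ∈? p ×-dec exit ∈? p

      gadgetSets gadgetSetsWithExit gadgetSetsWithEntry gadgetSetsThrough : List (Subset k)
      gadgetSets          = enumerate connected?
      gadgetSetsWithExit  = enumerate connectedWithExit?
      gadgetSetsWithEntry = enumerate connectedWithEntry?
      gadgetSetsThrough   = enumerate connectedThrough?

      ∈-gadgetSets : ∀ {p} → p ∈ˡ gadgetSets ⇔ ConnectedSet γ p
      ∈-gadgetSets = ∈-enumerate connected?

      ∈-gadgetSetsWithExit : ∀ {p} → p ∈ˡ gadgetSetsWithExit ⇔ (ConnectedSet γ p × exit ∈ p)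
      ∈-gadgetSetsWithExit = ∈-enumerate connectedWithExit?

      ∈-gadgetSetsWithEntry : ∀ {p} → p ∈ˡ gadgetSetsWithEntry ⇔ (ConnectedSet γ p × zero ∈ p)
      ∈-gadgetSetsWithEntry = ∈-enumerate connectedWithEntry?

      ∈-gadgetSetsThrough : ∀ {p} → p ∈ˡ gadgetSetsThrough ⇔ (ConnectedSet γ p × zero ∈ p × exit ∈ p)
      ∈-gadgetSetsThrough = ∈-enumerate connectedThrough?

      rootedSets : ∀ m → List (Subset (m * k))
      rootedSets zero    = []
      rootedSets (suc m) =
        map (_++ ∅) gadgetSetsWithEntry ++ˡ cartesianProductWith _++_ gadgetSetsThrough (rootedSets m)

      connectedSets : ∀ m → List (Subset (m * k))
      connectedSets zero    = []
      connectedSets (suc m) =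
        map (_++ ∅) gadgetSets ++ˡ map (∅ ++_) (connectedSets m) ++ˡ
        cartesianProductWith _++_ gadgetSetsWithExit (rootedSets m)

      rootedSets-sound : ∀ m {R} → R ∈ˡ rootedSets m → Rooted m R
      rootedSets-sound (suc m) R∈ with ∈ˡ.∈-++⁻ (map (_++ ∅) gadgetSetsWithEntry) R∈
      ... | inj₁ R∈ˡ with ∈ˡ.∈-map⁻ _ R∈ˡ
      ...   | p , p∈ , refl with to ∈-gadgetSetsWithEntry p∈
      ...     | cs , z∈p = Glue.rooted-first m p ∅ cs z∈p refl
      rootedSets-sound (suc m) R∈ | inj₂ R∈ʳ
        with ∈ˡ.∈-cartesianProductWith⁻ _++_ gadgetSetsThrough (rootedSets m) R∈ʳ
      ... | p , R , p∈ , R∈′ , refl with to ∈-gadgetSetsThrough p∈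
      ...   | cs , z∈p , x∈p = Glue.rooted-across m p R cs z∈p x∈p (rootedSets-sound m R∈′)

      rootedSets-complete : ∀ m S → Rooted m S → S ∈ˡ rootedSets m
      rootedSets-complete zero    S (_ , () , _)
      rootedSets-complete (suc m) S rooted with Vec.splitAt k S
      ... | p , R , refl with Glue.decompose-rooted m p R rooted
      ...   | Glue.first cs z∈p refl =
        ∈ˡ.∈-++⁺ˡ (∈ˡ.∈-map⁺ (_++ ∅) (from ∈-gadgetSetsWithEntry (cs , z∈p)))
      ...   | Glue.across cs z∈p x∈p r =
        ∈ˡ.∈-++⁺ʳ (map (_++ ∅) gadgetSetsWithEntry)
          (∈ˡ.∈-cartesianProductWith⁺ _++_ (from ∈-gadgetSetsThrough (cs , z∈p , x∈p))
            (rootedSets-complete m R r))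

      connectedSets-sound : ∀ m {S} → S ∈ˡ connectedSets m → ConnectedSet (chain m) S
      connectedSets-sound (suc m) S∈ with ∈ˡ.∈-++⁻ (map (_++ ∅) gadgetSets) S∈
      ... | inj₁ S∈₁ with ∈ˡ.∈-map⁻ _ S∈₁
      ...   | p , p∈ , refl = Glue.connected-first m p ∅ (to ∈-gadgetSets p∈) refl
      connectedSets-sound (suc m) S∈ | inj₂ S∈′ with ∈ˡ.∈-++⁻ (map (∅ ++_) (connectedSets m)) S∈′
      ... | inj₁ S∈₂ with ∈ˡ.∈-map⁻ _ S∈₂
      ...   | R , R∈ , refl = Glue.connected-rest m ∅ R refl (connectedSets-sound m R∈)
      connectedSets-sound (suc m) S∈ | inj₂ S∈′ | inj₂ S∈₃
        with ∈ˡ.∈-cartesianProductWith⁻ _++_ gadgetSetsWithExit (rootedSets m) S∈₃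
      ... | p , R , p∈ , R∈ , refl with to ∈-gadgetSetsWithExit p∈
      ...   | cs , x∈p = Glue.connected-across m p R cs x∈p (rootedSets-sound m R∈)

      connectedSets-complete : ∀ m S → ConnectedSet (chain m) S → S ∈ˡ connectedSets m
      connectedSets-complete zero    S ((() , _) , _)
      connectedSets-complete (suc m) S cs with Vec.splitAt k S
      ... | p , R , refl with Glue.decompose m p R cs
      ...   | Glue.first cs′ refl =
        ∈ˡ.∈-++⁺ˡ (∈ˡ.∈-map⁺ (_++ ∅) (from ∈-gadgetSets cs′))
      ...   | Glue.rest refl cs′ =
        ∈ˡ.∈-++⁺ʳ (map (_++ ∅) gadgetSets)
          (∈ˡ.∈-++⁺ˡ (∈ˡ.∈-map⁺ (∅ ++_) (connectedSets-complete m R cs′)))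
      ...   | Glue.across cs′ x∈p r =
        ∈ˡ.∈-++⁺ʳ (map (_++ ∅) gadgetSets) (∈ˡ.∈-++⁺ʳ (map (∅ ++_) (connectedSets m))
          (∈ˡ.∈-cartesianProductWith⁺ _++_ (from ∈-gadgetSetsWithExit (cs′ , x∈p))
            (rootedSets-complete m R r)))

      private
        ++∅-injective : ∀ {n} {p q : Subset k} → p ++ ∅ {n} ≡ q ++ ∅ → p ≡ q
        ++∅-injective {p = p} {q} = ++-injectiveˡ p q

        ∅++-injective : ∀ {n} {p q : Subset n} → ∅ {k} ++ p ≡ ∅ ++ q → p ≡ q
        ∅++-injective = ++-injectiveʳ ∅ ∅

        ++-injective′ : ∀ {n} {w x : Subset k} {y z : Subset n} → w ++ y ≡ x ++ z → w ≡ x × y ≡ z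
        ++-injective′ {w = w} {x} = ++-injective w x

      rootedSets-unique : ∀ m → Unique (rootedSets m)
      rootedSets-unique zero    = []
      rootedSets-unique (suc m) =
        Unique.++⁺ (Unique.map⁺ ++∅-injective (enumerate-unique connectedWithEntry?))
          (Unique.cartesianProductWith⁺ _++_ ++-injective′
            (enumerate-unique connectedThrough?) (rootedSets-unique m))
          disjoint
        where
        disjoint : ∀ {S} → S ∈ˡ map (_++ ∅) gadgetSetsWithEntry ×
                           S ∈ˡ cartesianProductWith _++_ gadgetSetsThrough (rootedSets m) → ⊥
        disjoint (S∈₁ , S∈₂)
          with ∈ˡ.∈-map⁻ _ S∈₁ | ∈ˡ.∈-cartesianProductWith⁻ _++_ gadgetSetsThrough (rootedSets m) S∈₂
        ... | _ , _ , refl | _ , _ , _ , R∈ , eq =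
          connectedSet-nonempty (proj₁ (rootedSets-sound m R∈)) (sym (proj₂ (++-injective′ eq)))

      connectedSets-unique : ∀ m → Unique (connectedSets m)
      connectedSets-unique zero    = []
      connectedSets-unique (suc m) =
        Unique.++⁺ (Unique.map⁺ ++∅-injective (enumerate-unique connected?))
          (Unique.++⁺ (Unique.map⁺ ∅++-injective (connectedSets-unique m))
            (Unique.cartesianProductWith⁺ _++_ ++-injective′
              (enumerate-unique connectedWithExit?) (rootedSets-unique m))
            disjoint₂₃)
          disjoint₁
        where
        disjoint₂₃ : ∀ {S} → S ∈ˡ map (∅ ++_) (connectedSets m) ×
                             S ∈ˡ cartesianProductWith _++_ gadgetSetsWithExit (rootedSets m) → ⊥
        disjoint₂₃ (S∈₂ , S∈₃)
          with ∈ˡ.∈-map⁻ _ S∈₂ | ∈ˡ.∈-cartesianProductWith⁻ _++_ gadgetSetsWithExit (rootedSets m) S∈₃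
        ... | _ , _ , refl | p , _ , p∈ , _ , eq =
          ∉⊥ (subst (exit ∈_) (sym (proj₁ (++-injective′ eq))) (proj₂ (to ∈-gadgetSetsWithExit p∈)))

        disjoint₁ : ∀ {S} → S ∈ˡ map (_++ ∅) gadgetSets ×
                            S ∈ˡ map (∅ ++_) (connectedSets m) ++ˡ
                                 cartesianProductWith _++_ gadgetSetsWithExit (rootedSets m) → ⊥
        disjoint₁ (S∈₁ , S∈′) with ∈ˡ.∈-map⁻ _ S∈₁
        ... | p , p∈ , refl with ∈ˡ.∈-++⁻ (map (∅ ++_) (connectedSets m)) S∈′
        ...   | inj₁ S∈₂ with ∈ˡ.∈-map⁻ _ S∈₂
        ...     | _ , _ , eq =
          connectedSet-nonempty (to ∈-gadgetSets p∈) (proj₁ (++-injective′ eq))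
        disjoint₁ (S∈₁ , S∈′) | p , p∈ , refl | inj₂ S∈₃
          with ∈ˡ.∈-cartesianProductWith⁻ _++_ gadgetSetsWithExit (rootedSets m) S∈₃
        ... | _ , _ , _ , R∈ , eq =
          connectedSet-nonempty (proj₁ (rootedSets-sound m R∈)) (sym (proj₂ (++-injective′ eq)))

      connectedSets-enumerates : ∀ m → ConnSetList (chain m) (connectedSets m)
      connectedSets-enumerates m =
        connectedSets-unique m , λ S → mk⇔ (connectedSets-sound m) (connectedSets-complete m S)

      length-rootedSets-suc : ∀ m → length (rootedSets (suc m)) ≡
        length gadgetSetsWithEntry + length gadgetSetsThrough * length (rootedSets m)
      length-rootedSets-suc m = trans (length-++ (map (_++ ∅) gadgetSetsWithEntry))
        (cong₂ _+_ (length-map _ gadgetSetsWithEntry)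
                   (length-cartesianProductWith _++_ gadgetSetsThrough (rootedSets m)))

      weight-rootedSets-suc : ∀ m → weight (rootedSets (suc m)) ≡
        weight gadgetSetsWithEntry +
        (weight gadgetSetsThrough * length (rootedSets m) + length gadgetSetsThrough * weight (rootedSets m))
      weight-rootedSets-suc m = trans (weight-++ (map (_++ ∅) gadgetSetsWithEntry) _)
        (cong₂ _+_ (weight-map-++∅ gadgetSetsWithEntry)
                   (weight-cartesianProduct gadgetSetsThrough (rootedSets m)))

      length-connectedSets-suc : ∀ m → length (connectedSets (suc m)) ≡
        length gadgetSets + (length (connectedSets m) + length gadgetSetsWithExit * length (rootedSets m))
      length-connectedSets-suc m = trans (length-++ (map (_++ ∅) gadgetSets))
        (cong₂ _+_ (length-map _ gadgetSets) (trans (length-++ (map (∅ ++_) (connectedSets m)))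
          (cong₂ _+_ (length-map _ (connectedSets m))
                     (length-cartesianProductWith _++_ gadgetSetsWithExit (rootedSets m)))))

      weight-connectedSets-suc : ∀ m → weight (connectedSets (suc m)) ≡
        weight gadgetSets + (weight (connectedSets m) +
          (weight gadgetSetsWithExit * length (rootedSets m) + length gadgetSetsWithExit * weight (rootedSets m)))
      weight-connectedSets-suc m = trans (weight-++ (map (_++ ∅) gadgetSets) _)
        (cong₂ _+_ (weight-map-++∅ gadgetSets) (trans (weight-++ (map (∅ ++_) (connectedSets m)) _)
          (cong₂ _+_ (weight-map-∅++ (connectedSets m))
                     (weight-cartesianProduct gadgetSetsWithExit (rootedSets m)))))

    rooted-full : ConnectedSet γ (full k) → ∀ m → Rooted (suc m) (full (suc m * k))
    rooted-full cs zero    rewrite full-++ k 0 =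
      Glue.rooted-first 0 (full k) [] cs (∈-full zero) refl
    rooted-full cs (suc m) rewrite full-++ k (suc m * k) =
      Glue.rooted-across (suc m) (full k) (full (suc m * k)) cs (∈-full zero) (∈-full exit) (rooted-full cs m)

    connected-full : ConnectedSet γ (full k) → ∀ m → Connected (chain (suc m))
    connected-full cs m = proj₁ (rooted-full cs m)

    private
      n≮k↑ʳ : ∀ {n} (i : Fin k) (b : Fin n) → ¬ (k ↑ʳ b) < (i ↑ˡ n)
      n≮k↑ʳ {n} i b b<i = <-irrefl refl (begin-strict
        k             ≤⟨ m≤m+n k (toℕ b) ⟩
        k + toℕ b     ≡⟨ toℕ-↑ʳ k b ⟨
        toℕ (k ↑ʳ b)  <⟨ b<i ⟩
        toℕ (i ↑ˡ n)  ≡⟨ toℕ-↑ˡ i n ⟩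
        toℕ i         <⟨ toℕ<n i ⟩
        k             ∎)
        where open ≤-Reasoning

      ↑ˡ-<⁻ : ∀ {n} {i j : Fin k} → (i ↑ˡ n) < (j ↑ˡ n) → i < j
      ↑ˡ-<⁻ {n} {i} {j} = subst₂ ℕ._<_ (toℕ-↑ˡ i n) (toℕ-↑ˡ j n)

      ↑ʳ-<⁻ : ∀ {n} {a b : Fin n} → (k ↑ʳ a) < (k ↑ʳ b) → a < b
      ↑ʳ-<⁻ {a = a} {b} a<b =
        +-cancelˡ-< k (toℕ a) (toℕ b) (subst₂ ℕ._<_ (toℕ-↑ʳ k a) (toℕ-↑ʳ k b) a<b)

      nothing-below-entry : ∀ {n} {a c : Fin n} → isZero a ≡ true → ¬ (k ↑ʳ c) < (k ↑ʳ a)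
      nothing-below-entry {a = zero} _ c<a = n≮0 (↑ʳ-<⁻ c<a)

    chain-atMostOneLowerNeighbour : AtMostOneLowerNeighbour γ → ∀ m → AtMostOneLowerNeighbour (chain m)
    chain-atMostOneLowerNeighbour low (suc m) u v w uv uw v<u w<u with split k u | split k v | split k w
    ... | left i  | left j  | left l  = cong (_↑ˡ m * k)
      (low i j l (trans (sym (adj-↑ˡ↑ˡ m i j)) uv) (trans (sym (adj-↑ˡ↑ˡ m i l)) uw)
        (↑ˡ-<⁻ v<u) (↑ˡ-<⁻ w<u))
    ... | left i  | right b | _       = ⊥-elim (n≮k↑ʳ i b v<u)
    ... | left i  | left j  | right c = ⊥-elim (n≮k↑ʳ i c w<u)
    ... | right a | left j  | left l  =
      cong (_↑ˡ m * k)
        (trans (proj₂ (crossing-↑ʳ↑ˡ m a j uv)) (sym (proj₂ (crossing-↑ʳ↑ˡ m a l uw))))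
    ... | right a | left j  | right c = ⊥-elim (nothing-below-entry (proj₁ (crossing-↑ʳ↑ˡ m a j uv)) w<u)
    ... | right a | right b | left l  = ⊥-elim (nothing-below-entry (proj₁ (crossing-↑ʳ↑ˡ m a l uw)) v<u)
    ... | right a | right b | right c = cong (k ↑ʳ_) (chain-atMostOneLowerNeighbour low m a b c
      (trans (sym (adj-↑ʳ↑ʳ m a b)) uv) (trans (sym (adj-↑ʳ↑ʳ m a c)) uw)
      (↑ʳ-<⁻ v<u) (↑ʳ-<⁻ w<u))

    entryCount : ℕ → ℕ
    entryCount m = ∣ tabulate (isZero {m * k}) ∣

    entryCount-suc : ∀ m → entryCount (suc m) ≡ 1
    entryCount-suc m = cong suc (∣tabulate-false∣ (g + m * k))

    degree-↑ˡ : ∀ m i → degree (chain (suc m)) (i ↑ˡ m * k) ≡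
                degree γ i + (if isExit i then entryCount m else 0)
    degree-↑ˡ m i = begin
      degree (chain (suc m)) (i ↑ˡ m * k)
        ≡⟨ ∣tabulate∣-++ k (chainAdj (suc m) (i ↑ˡ m * k)) ⟩
      ∣ tabulate (λ j → chainAdj (suc m) (i ↑ˡ m * k) (j ↑ˡ m * k)) ∣ +
      ∣ tabulate (λ b → chainAdj (suc m) (i ↑ˡ m * k) (k ↑ʳ b)) ∣
        ≡⟨ cong₂ _+_ (cong ∣_∣ (tabulate-cong (adj-↑ˡ↑ˡ m i)))
                     (cong ∣_∣ (tabulate-cong (adj-↑ˡ↑ʳ m i))) ⟩
      degree γ i + ∣ tabulate (λ (b : Fin (m * k)) → isExit i ∧ isZero b) ∣
        ≡⟨ cong (degree γ i +_) (towardsRest (isExit i)) ⟩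
      degree γ i + (if isExit i then entryCount m else 0)
        ∎
      where
      open ≡-Reasoning
      towardsRest : ∀ c →
        ∣ tabulate (λ (b : Fin (m * k)) → c ∧ isZero b) ∣ ≡ (if c then entryCount m else 0)
      towardsRest true  = refl
      towardsRest false = ∣tabulate-false∣ (m * k)

    degree-↑ʳ : ∀ m a → degree (chain (suc m)) (k ↑ʳ a) ≡ (if isZero a then 1 else 0) + degree (chain m) a
    degree-↑ʳ m a = begin
      degree (chain (suc m)) (k ↑ʳ a)
        ≡⟨ ∣tabulate∣-++ k (chainAdj (suc m) (k ↑ʳ a)) ⟩
      ∣ tabulate (λ j → chainAdj (suc m) (k ↑ʳ a) (j ↑ˡ m * k)) ∣ +
      ∣ tabulate (λ b → chainAdj (suc m) (k ↑ʳ a) (k ↑ʳ b)) ∣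
        ≡⟨ cong₂ _+_ (cong ∣_∣ (tabulate-cong (adj-↑ʳ↑ˡ m a)))
                     (cong ∣_∣ (tabulate-cong (adj-↑ʳ↑ʳ m a))) ⟩
      ∣ tabulate (λ (j : Fin k) → isZero a ∧ isExit j) ∣ + degree (chain m) a
        ≡⟨ cong (_+ degree (chain m) a) (towardsGadget (isZero a)) ⟩
      (if isZero a then 1 else 0) + degree (chain m) a
        ∎
      where
      open ≡-Reasoning
      towardsGadget : ∀ c → ∣ tabulate (λ (j : Fin k) → c ∧ isExit j) ∣ ≡ (if c then 1 else 0)
      towardsGadget true  = ∣tabulate-≟∣ exit
      towardsGadget false = ∣tabulate-false∣ k

    firstBlockLeaves : ℕ → ℕ
    firstBlockLeaves e = ∣ tabulate (λ i → (degree γ i + (if isExit i then e else 0)) ℕ.≡ᵇ 1) ∣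

    leaves-suc : ∀ m → leaves (chain (suc m)) ≡
      firstBlockLeaves (entryCount m) +
      ∣ tabulate (λ a → ((if isZero a then 1 else 0) + degree (chain m) a) ℕ.≡ᵇ 1) ∣
    leaves-suc m = trans (∣tabulate∣-++ k (λ u → degree (chain (suc m)) u ℕ.≡ᵇ 1))
      (cong₂ _+_ (cong ∣_∣ (tabulate-cong (λ i → cong (ℕ._≡ᵇ 1) (degree-↑ˡ m i))))
                 (cong ∣_∣ (tabulate-cong (λ a → cong (ℕ._≡ᵇ 1) (degree-↑ʳ m a)))))

  chain-mono : ∀ {g} {γ γ′ : Graph (suc g)} (exit : Fin (suc g)) →
               (∀ a b → adj γ′ a b ≡ true → adj γ a b ≡ true) →
               ∀ m u v → adj (Chain.chain γ′ exit m) u v ≡ true → adj (Chain.chain γ exit m) u v ≡ true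
  chain-mono {g} exit γ′⊆γ (suc m) u v e with splitAt (suc g) u | splitAt (suc g) v
  ... | inj₁ a | inj₁ b = γ′⊆γ a b e
  ... | inj₁ a | inj₂ j = e
  ... | inj₂ i | inj₁ b = e
  ... | inj₂ i | inj₂ j = chain-mono exit γ′⊆γ m i j e

module Recurrences where

  open import Data.Nat using (ℕ; zero; suc; _+_; _*_; _≤_)
  open import Data.Nat.Properties using (*-cancelˡ-≤; *-assoc; m≤m+n; ≤-reflexive; ≤-trans)
  open import Data.Nat.Tactic.RingSolver using (solve)
  open import Data.List using ([]; _∷_)
  open import Relation.Binary.PropositionalEquality
  open ≡-Reasoning

  -- Literals are kept last in sums: Agda unfolds `literal * (literal + x)` into unary numerals,
  -- which makes the solver steps below very slow.
  rootedCount rootedWeight connCount connWeight : ℕ → ℕ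
  rootedCount  zero    = 0
  rootedCount  (suc m) = 9 * rootedCount m + 21
  rootedWeight zero    = 0
  rootedWeight (suc m) = 41 * rootedCount m + 9 * rootedWeight m + 79
  connCount    zero    = 0
  connCount    (suc m) = connCount m + 21 * rootedCount m + 47
  connWeight   zero    = 0
  connWeight   (suc m) = connWeight m + 79 * rootedCount m + 21 * rootedWeight m + 147

  -- `deficit` is 324 m · connCount times the amount by which connWeight / (6 m · connCount) falls
  -- short of 41/54; the other fields are what it takes to propagate deficit ≤ 150 · connCount.
  record Invariant (m : ℕ) : Set where
    field
      rootedDeficit rootedSlack deficit deficitSlack : ℕ
      counts-linear   : 21 * rootedCount m ≡ 8 * connCount m + 65 * m
      rooted-deficit  : 41 * m * rootedCount m ≡ 9 * rootedWeight m + rootedDeficit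
      rooted-slack    : 25 * rootedCount m ≡ 2 * rootedDeficit + 216 * m + rootedSlack
      conn-deficit    : 246 * m * connCount m ≡ 54 * connWeight m + deficit
      deficit-slack   : 3150 * connCount m ≡ 21 * deficit + deficitSlack

  counts-linear-step : ∀ m p c → 21 * p ≡ 8 * c + 65 * m →
    21 * (9 * p + 21) ≡ 8 * (c + 21 * p + 47) + 65 * suc m
  counts-linear-step m p c h = begin
    21 * (9 * p + 21)                                ≡⟨ solve (p ∷ []) ⟩
    441 + 9 * (21 * p)                               ≡⟨ cong (λ x → 441 + 9 * x) h ⟩
    441 + 9 * (8 * c + 65 * m)                       ≡⟨ solve (c ∷ m ∷ []) ⟩
    8 * (c + (8 * c + 65 * m) + 47) + 65 * suc m   ≡⟨ cong (λ x → 8 * (c + x + 47) + 65 * suc m) h ⟨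
    8 * (c + 21 * p + 47) + 65 * suc m             ∎

  rooted-deficit-step : ∀ m p s d → 41 * m * p ≡ 9 * s + d →
    41 * suc m * (9 * p + 21) ≡ 9 * (41 * p + 9 * s + 79) + (9 * d + 861 * m + 150)
  rooted-deficit-step m p s d h = begin
    41 * suc m * (9 * p + 21)                        ≡⟨ solve (m ∷ p ∷ []) ⟩
    9 * (41 * m * p) + 861 * m + 861 + 369 * p       ≡⟨ cong (λ x → 9 * x + 861 * m + 861 + 369 * p) h ⟩
    9 * (9 * s + d) + 861 * m + 861 + 369 * p        ≡⟨ solve (m ∷ p ∷ s ∷ d ∷ []) ⟩
    9 * (41 * p + 9 * s + 79) + (9 * d + 861 * m + 150) ∎

  rooted-slack-step : ∀ m p d r → 25 * p ≡ 2 * d + 216 * m + r →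
    25 * (9 * p + 21) ≡ 2 * (9 * d + 861 * m + 150) + 216 * suc m + (6 * m + 9 * r + 9)
  rooted-slack-step m p d r h = begin
    25 * (9 * p + 21)                                ≡⟨ solve (p ∷ []) ⟩
    525 + 9 * (25 * p)                               ≡⟨ cong (λ x → 525 + 9 * x) h ⟩
    525 + 9 * (2 * d + 216 * m + r)                  ≡⟨ solve (m ∷ d ∷ r ∷ []) ⟩
    2 * (9 * d + 861 * m + 150) + 216 * suc m + (6 * m + 9 * r + 9) ∎

  conn-deficit-step : ∀ m p s c w d e → 41 * m * p ≡ 9 * s + d → 246 * m * c ≡ 54 * w + e →
    246 * suc m * (c + 21 * p + 47) ≡
    54 * (w + 79 * p + 21 * s + 147) + (e + 246 * c + 11562 * m + 3624 + 900 * p + 126 * d)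
  conn-deficit-step m p s c w d e h₁ h₂ = begin
    246 * suc m * (c + 21 * p + 47)
      ≡⟨ solve (m ∷ c ∷ p ∷ []) ⟩
    246 * m * c + 126 * (41 * m * p) + 246 * c + 11562 * m + 11562 + 5166 * p
      ≡⟨ cong₂ (λ x y → x + 126 * y + 246 * c + 11562 * m + 11562 + 5166 * p) h₂ h₁ ⟩
    (54 * w + e) + 126 * (9 * s + d) + 246 * c + 11562 * m + 11562 + 5166 * p
      ≡⟨ solve (m ∷ c ∷ p ∷ s ∷ w ∷ d ∷ e ∷ []) ⟩
    54 * (w + 79 * p + 21 * s + 147) + (e + 246 * c + 11562 * m + 3624 + 900 * p + 126 * d)
      ∎

  deficit-slack-step : ∀ m p c d r e t →
    21 * p ≡ 8 * c + 65 * m → 25 * p ≡ 2 * d + 216 * m + r → 3150 * c ≡ 21 * e + t →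
    3150 * (c + 21 * p + 47) ≡
    21 * (e + 246 * c + 11562 * m + 3624 + 900 * p + 126 * d) + (t + 234 * c + 71946 + 86841 * m + 1323 * r)
  deficit-slack-step m p c d r e t h₀ h₁ h₂ = begin
    3150 * (c + 21 * p + 47)
      ≡⟨ solve (c ∷ p ∷ []) ⟩
    3150 * c + 1323 * (25 * p) + 675 * (21 * p) + 148050 + 18900 * p
      ≡⟨ cong₂ (λ x y → x + 1323 * y + 675 * (21 * p) + 148050 + 18900 * p) h₂ h₁ ⟩
    (21 * e + t) + 1323 * (2 * d + 216 * m + r) + 675 * (21 * p) + 148050 + 18900 * p
      ≡⟨ cong (λ x → (21 * e + t) + 1323 * (2 * d + 216 * m + r) + 675 * x + 148050 + 18900 * p) h₀ ⟩
    (21 * e + t) + 1323 * (2 * d + 216 * m + r) + 675 * (8 * c + 65 * m) + 148050 + 18900 * p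
      ≡⟨ solve (m ∷ c ∷ p ∷ d ∷ r ∷ e ∷ t ∷ []) ⟩
    21 * (e + 246 * c + 11562 * m + 3624 + 900 * p + 126 * d) + (t + 234 * c + 71946 + 86841 * m + 1323 * r)
      ∎

  invariant : ∀ m → Invariant m
  invariant zero    = record
    { rootedDeficit = 0 ; rootedSlack = 0 ; deficit = 0 ; deficitSlack = 0
    ; counts-linear = refl ; rooted-deficit = refl ; rooted-slack = refl
    ; conn-deficit = refl ; deficit-slack = refl
    }
  invariant (suc m) = record
    { rootedDeficit = 9 * d + 861 * m + 150
    ; rootedSlack   = 6 * m + 9 * r + 9
    ; deficit       = e + 246 * c + 11562 * m + 3624 + 900 * p + 126 * d
    ; deficitSlack  = t + 234 * c + 71946 + 86841 * m + 1323 * r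
    ; counts-linear  = counts-linear-step m p c counts-linear
    ; rooted-deficit = rooted-deficit-step m p s d rooted-deficit
    ; rooted-slack   = rooted-slack-step m p d r rooted-slack
    ; conn-deficit   = conn-deficit-step m p s c w d e rooted-deficit conn-deficit
    ; deficit-slack  = deficit-slack-step m p c d r e t counts-linear rooted-slack deficit-slack
    }
    where
    open Invariant (invariant m) renaming (rootedDeficit to d; rootedSlack to r; deficit to e; deficitSlack to t)
    p = rootedCount m
    s = rootedWeight m
    c = connCount m
    w = connWeight m

  deficit-bound : ∀ m → Invariant.deficit (invariant m) ≤ 150 * connCount m
  deficit-bound m = *-cancelˡ-≤ 21 (≤-trans (m≤m+n (21 * e) t) (≤-reflexive (begin
    21 * e + t         ≡⟨ deficit-slack ⟨
    3150 * connCount m ≡⟨ *-assoc 21 150 (connCount m) ⟩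
    21 * (150 * connCount m) ∎)))
    where open Invariant (invariant m) renaming (deficit to e; deficitSlack to t)

module Convergence where

  open import Defs using (ratio)
  open import Data.Nat as ℕ using (ℕ; zero; suc; s≤s)
  import Data.Nat.Properties as ℕ
  import Data.Nat.Tactic.RingSolver as ℕ-Solver
  open import Data.Integer as ℤ using (ℤ; +_; -[1+_]; +<+)
  import Data.Integer.Properties as ℤ
  open import Data.Integer.Tactic.RingSolver using (solve)
  open import Data.List using ([]; _∷_)
  open import Data.Rational as ℚ using (ℚ; mkℚ; 0ℚ)
  import Data.Rational.Properties as ℚ
  open import Data.Rational.Unnormalised as ℚᵘ using (ℚᵘ; mkℚᵘ; *<*)
  import Data.Rational.Unnormalised.Properties as ℚᵘ
  open import Data.Nat.Coprimality using (Coprime)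
  open import Data.Product using (Σ; _,_)
  open import Relation.Binary.PropositionalEquality

  cross-difference : ∀ (X B A Y F : ℤ) → A ℤ.* Y ≡ B ℤ.* X ℤ.+ F →
                     X ℤ.* B ℤ.+ ℤ.- A ℤ.* Y ≡ ℤ.- F
  cross-difference X B A Y F h = begin
    X ℤ.* B ℤ.+ ℤ.- A ℤ.* Y          ≡⟨ solve (X ∷ B ∷ A ∷ Y ∷ []) ⟩
    X ℤ.* B ℤ.- A ℤ.* Y              ≡⟨ cong (λ z → X ℤ.* B ℤ.- z) h ⟩
    X ℤ.* B ℤ.- (B ℤ.* X ℤ.+ F)      ≡⟨ solve (X ∷ B ∷ F ∷ []) ⟩
    ℤ.- F                            ∎
    where open ≡-Reasoning

  distance-numerator : ∀ a b x y E → a ℕ.* suc y ≡ suc b ℕ.* x ℕ.+ E →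
    ℚᵘ.numerator ℚᵘ.∣ mkℚᵘ (+ x) y ℚᵘ.- mkℚᵘ (+ a) b ∣ ≡ + E
  distance-numerator a b x y E deficit = trans
    (cong (λ z → + ℤ.∣ z ∣) (cross-difference (+ x) (+ suc b) (+ a) (+ suc y) (+ E) deficitℤ))
    (cong +_ (ℤ.∣-i∣≡∣i∣ (+ E)))
    where
    open ≡-Reasoning
    deficitℤ : + a ℤ.* + suc y ≡ + suc b ℤ.* + x ℤ.+ + E
    deficitℤ = begin
      + a ℤ.* + suc y             ≡⟨ ℤ.pos-* a (suc y) ⟨
      + (a ℕ.* suc y)             ≡⟨ cong +_ deficit ⟩
      + (suc b ℕ.* x ℕ.+ E)       ≡⟨ ℤ.pos-+ (suc b ℕ.* x) E ⟩
      + (suc b ℕ.* x) ℤ.+ + E     ≡⟨ cong (ℤ._+ + E) (ℤ.pos-* (suc b) x) ⟩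
      + suc b ℤ.* + x ℤ.+ + E     ∎

  ratio-near : ∀ a b x y E p q .(cop : Coprime (suc p) (suc q)) →
    a ℕ.* suc y ≡ suc b ℕ.* x ℕ.+ E → E ℕ.* suc q ℕ.< suc p ℕ.* (suc y ℕ.* suc b) →
    ℚ.∣ ratio x (suc y) ℚ.- + a ℚ./ suc b ∣ ℚ.< mkℚ (+ suc p) q cop
  ratio-near a b x y E p q cop deficit small =
    ℚ.toℚᵘ-cancel-< (ℚᵘ.<-respˡ-≃ (ℚᵘ.≃-sym toℚᵘ-distance)
      (*<* (subst₂ ℤ._<_ numerator-side denominator-side (+<+ small))))
    where
    u v : ℚᵘ
    u = mkℚᵘ (+ x) y
    v = mkℚᵘ (+ a) b

    toℚᵘ-distance : ℚ.toℚᵘ ℚ.∣ ratio x (suc y) ℚ.- + a ℚ./ suc b ∣ ℚᵘ.≃ ℚᵘ.∣ u ℚᵘ.- v ∣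
    toℚᵘ-distance = ℚᵘ.≃-trans (ℚ.toℚᵘ-homo-∣-∣ (ratio x (suc y) ℚ.- + a ℚ./ suc b))
      (ℚᵘ.∣-∣-cong (ℚᵘ.≃-trans (ℚ.toℚᵘ-homo-+ (ratio x (suc y)) (ℚ.- (+ a ℚ./ suc b)))
        (ℚᵘ.+-cong (ℚ.toℚᵘ-fromℚᵘ u)
          (ℚᵘ.≃-trans (ℚ.toℚᵘ-homo‿- (+ a ℚ./ suc b)) (ℚᵘ.-‿cong (ℚ.toℚᵘ-fromℚᵘ v))))))

    numerator-side : + (E ℕ.* suc q) ≡ ℚᵘ.numerator ℚᵘ.∣ u ℚᵘ.- v ∣ ℤ.* + suc q
    numerator-side = trans (ℤ.pos-* E (suc q)) (cong (ℤ._* + suc q) (sym (distance-numerator a b x y E deficit)))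

    denominator-side :
      + (suc p ℕ.* (suc y ℕ.* suc b)) ≡ + suc p ℤ.* ℚᵘ.denominator ℚᵘ.∣ u ℚᵘ.- v ∣
    denominator-side = ℤ.pos-* (suc p) (suc y ℕ.* suc b)

  -- For ε = (p+1)/(q+1) take N = q: the distance is at most 150/(324 (k+1)) < 1/(q+1) ≤ ε.
  eventually-near : ∀ (ε : ℚ) → 0ℚ ℚ.< ε → Σ ℕ λ N → ∀ k x c E → N ℕ.≤ k →
    41 ℕ.* (6 ℕ.* suc k ℕ.* c) ≡ 54 ℕ.* x ℕ.+ E → E ℕ.≤ 150 ℕ.* c → 0 ℕ.< c →
    ℚ.∣ ratio x (6 ℕ.* suc k ℕ.* c) ℚ.- + 41 ℚ./ 54 ∣ ℚ.< ε
  eventually-near (mkℚ (+ suc p) q cop) _ = q , near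
    where
    near : ∀ k x c E → q ℕ.≤ k →
           41 ℕ.* (6 ℕ.* suc k ℕ.* c) ≡ 54 ℕ.* x ℕ.+ E → E ℕ.≤ 150 ℕ.* c → 0 ℕ.< c →
           ℚ.∣ ratio x (6 ℕ.* suc k ℕ.* c) ℚ.- + 41 ℚ./ 54 ∣ ℚ.< mkℚ (+ suc p) q cop
    near k x (suc c) E q≤k deficit E≤150c _ = ratio-near 41 53 x _ E p q cop deficit (begin-strict
      E ℕ.* suc q                              ≤⟨ ℕ.*-monoˡ-≤ (suc q) E≤150c ⟩
      150 ℕ.* suc c ℕ.* suc q                  <⟨ ℕ.*-monoˡ-< (suc q) (ℕ.*-monoˡ-< (suc c) (ℕ.<ᵇ⇒< 150 324 _)) ⟩
      324 ℕ.* suc c ℕ.* suc q                  ≤⟨ ℕ.*-monoʳ-≤ (324 ℕ.* suc c) (s≤s q≤k) ⟩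
      324 ℕ.* suc c ℕ.* suc k                  ≡⟨ ℕ-Solver.solve (c ∷ k ∷ []) ⟩
      6 ℕ.* suc k ℕ.* suc c ℕ.* 54             ≤⟨ ℕ.m≤n*m (6 ℕ.* suc k ℕ.* suc c ℕ.* 54) (suc p) ⟩
      suc p ℕ.* (6 ℕ.* suc k ℕ.* suc c ℕ.* 54) ∎)
      where open ℕ.≤-Reasoning
  eventually-near (mkℚ (+ zero) _ _) (ℚ.*<* (+<+ ()))
  eventually-near (mkℚ -[1+ _ ] _ _) (ℚ.*<* ())

module Gadget where

  open import Defs hiding (sym)
  open import Data.Nat using (ℕ; zero; suc; _+_; _*_; _≡ᵇ_)
  open import Data.Nat.Properties using (+-comm; +-assoc; *-suc)
  open import Data.Bool using (Bool; true; false; if_then_else_)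
  import Data.Bool.Properties as Bool
  open import Data.Fin using (Fin; zero; suc; toℕ; #_)
  import Data.Fin.Properties as Fin
  open import Data.Fin.Subset using (∣_∣)
  open import Data.Vec using (tabulate)
  open import Data.List using (length)
  open import Data.List.Relation.Unary.All using (lookup; all?)
  open import Function using (_∘_)
  open import Relation.Nullary.Decidable using (_→-dec_)
  open import Relation.Unary using (Decidable)
  open import Relation.Binary.PropositionalEquality
  open ≡-Reasoning
  open Graphs
  open Chains
  open Recurrences

  -- Entry 0, exit 5; the star centred at 1 is a spanning tree of the gadget.
  gadgetEdge : ℕ → ℕ → Bool
  gadgetEdge 0 1 = true
  gadgetEdge 0 2 = true
  gadgetEdge 1 2 = true
  gadgetEdge 1 3 = true
  gadgetEdge 1 4 = true
  gadgetEdge 1 5 = true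
  gadgetEdge 2 3 = true
  gadgetEdge 3 4 = true
  gadgetEdge 4 5 = true
  gadgetEdge _ _ = false

  starEdge : ℕ → ℕ → Bool
  starEdge 1 0 = true
  starEdge 1 2 = true
  starEdge 1 3 = true
  starEdge 1 4 = true
  starEdge 1 5 = true
  starEdge _ _ = false

  gadget : Graph 6
  gadget = undirected (λ u v → gadgetEdge (toℕ u) (toℕ v))
    (witness (Fin.all? λ v → gadgetEdge (toℕ v) (toℕ v) Bool.≟ false) refl)

  star : Graph 6
  star = undirected (λ u v → starEdge (toℕ u) (toℕ v))
    (witness (Fin.all? λ v → starEdge (toℕ v) (toℕ v) Bool.≟ false) refl)

  gadget-connected? : Decidable (ConnectedSet gadget)
  gadget-connected? p = Reachability.connectedSet? gadget p
    (lookup (witness (all? (Reachability.reachClosed? gadget) (subsets 6)) refl) (∈-subsets p))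

  open Chain.Enumeration gadget (# 5) gadget-connected?

  length-gadgetSets : length gadgetSets ≡ 47
  length-gadgetSets = refl

  weight-gadgetSets : weight gadgetSets ≡ 147
  weight-gadgetSets = refl

  length-gadgetSetsWithExit : length gadgetSetsWithExit ≡ 21
  length-gadgetSetsWithExit = refl

  weight-gadgetSetsWithExit : weight gadgetSetsWithExit ≡ 79
  weight-gadgetSetsWithExit = refl

  length-gadgetSetsWithEntry : length gadgetSetsWithEntry ≡ 21
  length-gadgetSetsWithEntry = refl

  weight-gadgetSetsWithEntry : weight gadgetSetsWithEntry ≡ 79
  weight-gadgetSetsWithEntry = refl

  length-gadgetSetsThrough : length gadgetSetsThrough ≡ 9
  length-gadgetSetsThrough = refl

  weight-gadgetSetsThrough : weight gadgetSetsThrough ≡ 41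
  weight-gadgetSetsThrough = refl

  length-rootedSets : ∀ m → length (rootedSets m) ≡ rootedCount m
  length-rootedSets zero    = refl
  length-rootedSets (suc m) = trans (length-rootedSets-suc m) (trans
    (cong₂ _+_ length-gadgetSetsWithEntry (cong₂ _*_ length-gadgetSetsThrough (length-rootedSets m)))
    (+-comm 21 _))

  weight-rootedSets : ∀ m → weight (rootedSets m) ≡ rootedWeight m
  weight-rootedSets zero    = refl
  weight-rootedSets (suc m) = trans (weight-rootedSets-suc m) (trans
    (cong₂ _+_ weight-gadgetSetsWithEntry
      (cong₂ _+_ (cong₂ _*_ weight-gadgetSetsThrough (length-rootedSets m))
                 (cong₂ _*_ length-gadgetSetsThrough (weight-rootedSets m))))
    (+-comm 79 _))

  length-connectedSets : ∀ m → length (connectedSets m) ≡ connCount m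
  length-connectedSets zero    = refl
  length-connectedSets (suc m) = trans (length-connectedSets-suc m) (trans
    (cong₂ _+_ length-gadgetSets
      (cong₂ _+_ (length-connectedSets m) (cong₂ _*_ length-gadgetSetsWithExit (length-rootedSets m))))
    (+-comm 47 _))

  weight-connectedSets : ∀ m → weight (connectedSets m) ≡ connWeight m
  weight-connectedSets zero    = refl
  weight-connectedSets (suc m) = trans (weight-connectedSets-suc m) (trans
    (cong₂ _+_ weight-gadgetSets
      (cong₂ _+_ (weight-connectedSets m)
        (cong₂ _+_ (cong₂ _*_ weight-gadgetSetsWithExit (length-rootedSets m))
                   (cong₂ _*_ length-gadgetSetsWithExit (weight-rootedSets m)))))
    (trans (+-comm 147 _) (cong (_+ 147) (sym (+-assoc (connWeight m) _ _)))))

  gadget-connected : ConnectedSet gadget (full 6)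
  gadget-connected = witness (gadget-connected? (full 6)) refl

  star-connected : ConnectedSet star (full 6)
  star-connected = witness (Reachability.connectedSet? star (full 6)
    (witness (Reachability.reachClosed? star (full 6)) refl)) refl

  star⊆gadget : ∀ a b → adj star a b ≡ true → adj gadget a b ≡ true
  star⊆gadget = witness (Fin.all? λ a → Fin.all? λ b →
    adj star a b Bool.≟ true →-dec adj gadget a b Bool.≟ true) refl

  star-atMostOneLowerNeighbour : AtMostOneLowerNeighbour star
  star-atMostOneLowerNeighbour = witness (Fin.all? λ u → Fin.all? λ v → Fin.all? λ w →
    adj star u v Bool.≟ true →-dec adj star u w Bool.≟ true →-dec
    v Fin.<? u →-dec w Fin.<? u →-dec v Fin.≟ w) refl

  starChain : ∀ m → Graph (m * 6)
  starChain = Chain.chain star (# 5)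

  open Chain star (# 5) using (entryCount; entryCount-suc; degree-↑ˡ; firstBlockLeaves; leaves-suc)

  -- The new first copy contributes the leaves 0, 2, 3, 4, and the entry of the old chain stops being one.
  leaves-starChain : ∀ m → leaves (starChain (suc m)) ≡ 3 * m + 5
  leaves-starChain zero    = refl
  leaves-starChain (suc m) = begin
    leaves (starChain (suc (suc m)))
      ≡⟨ leaves-suc (suc m) ⟩
    firstBlockLeaves (entryCount (suc m)) + ∣ tabulate isLeafAfterLink ∣
      ≡⟨ cong₂ _+_ (cong firstBlockLeaves (entryCount-suc m))
                   (∣tabulate∣-head-false isLeafAfterLink (cong (λ d → suc d ≡ᵇ 1) entry-degree)) ⟩
    4 + ∣ tabulate (isLeaf ∘ suc) ∣
      ≡⟨ cong (3 +_) (∣tabulate∣-head-true isLeaf (cong (_≡ᵇ 1) entry-degree)) ⟨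
    3 + leaves (starChain (suc m))
      ≡⟨ cong (3 +_) (leaves-starChain m) ⟩
    3 + (3 * m + 5)
      ≡⟨ trans (cong (_+ 5) (*-suc 3 m)) (+-assoc 3 (3 * m) 5) ⟨
    3 * suc m + 5
      ∎
    where
    isLeaf isLeafAfterLink : Fin (suc m * 6) → Bool
    isLeaf          a = degree (starChain (suc m)) a ≡ᵇ 1
    isLeafAfterLink a = ((if isZero a then 1 else 0) + degree (starChain (suc m)) a) ≡ᵇ 1

    entry-degree : degree (starChain (suc m)) zero ≡ 1
    entry-degree = degree-↑ˡ m zero

open import Defs hiding (sym)
open import Data.Nat using (ℕ; suc; _*_; _+_; _≥_)
open import Data.Nat.DivMod using (_/_)
open import Data.Fin.Subset using (Subset)
open import Data.List using (List)
open import Data.Product using (Σ; _×_)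
open import Data.Integer using (+_)
open import Data.Rational using (ℚ; 0ℚ; _<_; _-_; ∣_∣)
import Data.Rational
open import Relation.Binary.PropositionalEquality using (_≡_)
open import Data.Nat as ℕ using (s≤s; z≤n)
open import Data.Nat.Properties using (*-comm; m≤n+m; ≤-trans)
open import Data.Nat.DivMod using (m*n/n≡m)
open import Data.Nat.Tactic.RingSolver using (solve-∀)
open import Data.Fin using (#_)
open import Data.List using (length)
open import Data.Product using (_,_)
open import Function using (_∘_)
open import Relation.Binary.PropositionalEquality using (sym; trans; cong; cong₂; subst; module ≡-Reasoning)
open Graphs
open Chains
open Recurrences
open Convergence
open Gadget
open Chain.Enumeration gadget (# 5) gadget-connected?

record Realization (n w c : ℕ) : Set where
  field
    graph       : Graph n
    sets        : List (Subset n)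
    connected   : Connected graph
    enumerates  : ConnSetList graph sets
    tree        : Graph n
    spanning    : SpanningTree graph tree
    tree-leaves : leaves tree ≡ n / 2 + 2
    weight-sets : weight sets ≡ w
    length-sets : length sets ≡ c

half-order : ∀ k → suc k * 6 / 2 + 2 ≡ 3 * k + 5
half-order k = begin
  suc k * 6 / 2 + 2       ≡⟨ cong (λ n → n / 2 + 2) (double k) ⟩
  3 * suc k * 2 / 2 + 2   ≡⟨ cong (_+ 2) (m*n/n≡m (3 * suc k) 2) ⟩
  3 * suc k + 2           ≡⟨ shift k ⟩
  3 * k + 5               ∎
  where
  open ≡-Reasoning
  double : ∀ k → suc k * 6 ≡ 3 * suc k * 2
  double = solve-∀
  shift : ∀ k → 3 * suc k + 2 ≡ 3 * k + 5
  shift = solve-∀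

chainRealization : ∀ k → Realization (suc k * 6) (connWeight (suc k)) (connCount (suc k))
chainRealization k = record
  { graph       = Chain.chain gadget (# 5) (suc k)
  ; sets        = connectedSets (suc k)
  ; connected   = Chain.connected-full gadget (# 5) gadget-connected k
  ; enumerates  = connectedSets-enumerates (suc k)
  ; tree        = starChain (suc k)
  ; spanning    = chain-mono (# 5) star⊆gadget (suc k)
                , Chain.connected-full star (# 5) star-connected k
                , atMostOneLowerNeighbour⇒acyclic (starChain (suc k))
                    (Chain.chain-atMostOneLowerNeighbour star (# 5) star-atMostOneLowerNeighbour (suc k))
  ; tree-leaves = trans (leaves-starChain k) (sym (half-order k))
  ; weight-sets = weight-connectedSets (suc k)
  ; length-sets = length-connectedSets (suc k)
  }

realization : ∀ k → Realization (6 * suc k) (connWeight (suc k)) (connCount (suc k))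
realization k =
  subst (λ n → Realization n (connWeight (suc k)) (connCount (suc k))) (*-comm (suc k) 6) (chainRealization k)

density-realization : ∀ k →
  density (Realization.sets (realization k)) ≡ ratio (connWeight (suc k)) (6 * suc k * connCount (suc k))
density-realization k = cong₂ (λ w c → ratio w (6 * suc k * c)) weight-sets length-sets
  where open Realization (realization k)

density-deficit : ∀ k →
  41 * (6 * suc k * connCount (suc k)) ≡ 54 * connWeight (suc k) + Invariant.deficit (invariant (suc k))
density-deficit k = trans (rearrange k (connCount (suc k))) (Invariant.conn-deficit (invariant (suc k)))
  where
  rearrange : ∀ k c → 41 * (6 * suc k * c) ≡ 246 * suc k * c
  rearrange = solve-∀

connCount-positive : ∀ k → 0 ℕ.< connCount (suc k)
connCount-positive k = ≤-trans (s≤s z≤n) (m≤n+m 47 _)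

mainTheorem10 :
  Σ ((k : ℕ) → Graph (6 * suc k)) λ H →
  Σ ((k : ℕ) → List (Subset (6 * suc k))) λ L →
    ((k : ℕ) →
      Connected (H k)
      × ConnSetList (H k) (L k)
      × Σ (Graph (6 * suc k))
          (λ T → SpanningTree (H k) T × (leaves T ≡ (6 * suc k) / 2 + 2)))
    × ((ε : ℚ) → 0ℚ < ε →
        Σ ℕ λ N → (k : ℕ) → k ≥ N →
          ∣ density (L k) - (+ 41 Data.Rational./ 54) ∣ < ε)
mainTheorem10 =
  Realization.graph ∘ realization ,
  Realization.sets ∘ realization ,
  (λ k → let open Realization (realization k) in connected , enumerates , tree , spanning , tree-leaves) ,
  λ ε ε>0 → let (N , near) = eventually-near ε ε>0 in N , λ k k≥N →
    subst (λ d → ∣ d - (+ 41 Data.Rational./ 54) ∣ < ε) (sym (density-realization k))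
      (near k _ _ _ k≥N (density-deficit k) (deficit-bound (suc k)) (connCount-positive k))
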